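{- Let $G$ be a forbidden induced subgraph for the class of edge-apex cographs. Then no proper induced subgraph of $G$ contains two edge-disjoint induced copies of $P_4$.
   Context: All graphs are finite, simple and undirected. $P_4$ is the path on four vertices. A cograph is a graph with no induced subgraph isomorphic to $P_4$ (equivalently, generated from $K_1$ by complementation and disjoint union). A graph $G$ is an edge-apex cograph if $G$ is a cograph or $G$ has an edge $e$ such that $G-e$ (delete the edge, keep all vertices) is a cograph. A forbidden induced subgraph for the class of edge-apex cographs is a graph that is not an edge-apex cograph but all of whose proper induced subgraphs are edge-apex cographs. -}

module Defs where

open import Data.Nat using (ℕ; _<_)
open import Data.Fin using (Fin; zero; suc)
open import Data.Fin.Properties using (_≟_)
open import Data.Bool using (Bool; true; false; _∧_; _∨_; not)
open import Data.Bool.Properties using (∧-comm; ∨-comm)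
open import Data.Product using (Σ; ∃; _×_; _,_)
open import Data.Sum using (_⊎_)
open import Relation.Nullary using (¬_; does)
open import Relation.Binary.PropositionalEquality using (_≡_; refl; cong₂)
open import Function.Definitions using (Injective)

record Graph : Set where
  field
    n      : ℕ
    adj    : Fin n → Fin n → Bool
    sym    : ∀ i j → adj i j ≡ adj j i
    irrefl : ∀ i → adj i i ≡ false
open Graph public

record InducedEmbedding (H G : Graph) : Set where
  field
    f       : Fin (n H) → Fin (n G)
    inj     : Injective _≡_ _≡_ f
    preserv : ∀ i j → adj H i j ≡ adj G (f i) (f j)

InducedSubgraph : Graph → Graph → Set
InducedSubgraph H G = InducedEmbedding H G

ProperInducedSubgraph : Graph → Graph → Set
ProperInducedSubgraph H G = InducedEmbedding H G × n H < n G

p4adj : Fin 4 → Fin 4 → Bool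
p4adj zero (suc zero) = true
p4adj (suc zero) zero = true
p4adj (suc zero) (suc (suc zero)) = true
p4adj (suc (suc zero)) (suc zero) = true
p4adj (suc (suc zero)) (suc (suc (suc zero))) = true
p4adj (suc (suc (suc zero))) (suc (suc zero)) = true
p4adj _ _ = false

p4sym : ∀ i j → p4adj i j ≡ p4adj j i
p4sym zero zero = refl
p4sym zero (suc zero) = refl
p4sym zero (suc (suc zero)) = refl
p4sym zero (suc (suc (suc zero))) = refl
p4sym (suc zero) zero = refl
p4sym (suc zero) (suc zero) = refl
p4sym (suc zero) (suc (suc zero)) = refl
p4sym (suc zero) (suc (suc (suc zero))) = refl
p4sym (suc (suc zero)) zero = refl
p4sym (suc (suc zero)) (suc zero) = refl
p4sym (suc (suc zero)) (suc (suc zero)) = refl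
p4sym (suc (suc zero)) (suc (suc (suc zero))) = refl
p4sym (suc (suc (suc zero))) zero = refl
p4sym (suc (suc (suc zero))) (suc zero) = refl
p4sym (suc (suc (suc zero))) (suc (suc zero)) = refl
p4sym (suc (suc (suc zero))) (suc (suc (suc zero))) = refl

p4irrefl : ∀ i → p4adj i i ≡ false
p4irrefl zero = refl
p4irrefl (suc zero) = refl
p4irrefl (suc (suc zero)) = refl
p4irrefl (suc (suc (suc zero))) = refl

P4 : Graph
P4 = record { n = 4 ; adj = p4adj ; sym = p4sym ; irrefl = p4irrefl }

InducedP4 : Graph → Set
InducedP4 G = InducedEmbedding P4 G

IsCograph : Graph → Set
IsCograph G = ¬ InducedP4 G

private
  isUV : ∀ {m} → Fin m → Fin m → Fin m → Fin m → Bool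
  isUV u v i j = (does (i ≟ u) ∧ does (j ≟ v)) ∨ (does (i ≟ v) ∧ does (j ≟ u))

  isUV-sym : ∀ {m} (u v i j : Fin m) → isUV u v i j ≡ isUV u v j i
  isUV-sym u v i j rewrite ∧-comm (does (i ≟ u)) (does (j ≟ v))
                         | ∧-comm (does (i ≟ v)) (does (j ≟ u))
                         = ∨-comm (does (j ≟ v) ∧ does (i ≟ u)) (does (j ≟ u) ∧ does (i ≟ v))

deleteEdge : (G : Graph) → Fin (n G) → Fin (n G) → Graph
deleteEdge G u v = record
  { n = n G
  ; adj = λ i j → adj G i j ∧ not (isUV u v i j)
  ; sym = λ i j → cong₂ (λ a b → a ∧ not b) (Graph.sym G i j) (isUV-sym u v i j)
  ; irrefl = λ i → cong₂ (λ a b → a ∧ not b) (Graph.irrefl G i) (refl {x = isUV u v i i})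
  }

IsEdgeApexCograph : Graph → Set
IsEdgeApexCograph G =
  IsCograph G ⊎ Σ (Fin (n G)) (λ u → Σ (Fin (n G)) (λ v →
    adj G u v ≡ true × IsCograph (deleteEdge G u v)))

ForbiddenInducedSubgraph : Graph → Set
ForbiddenInducedSubgraph G =
  ¬ IsEdgeApexCograph G ×
  (∀ (H : Graph) → ProperInducedSubgraph H G → IsEdgeApexCograph H)

-- Two edge-disjoint induced copies of P4 in H (they may share vertices,
-- but no edge of one copy is an edge of the other).
TwoEdgeDisjointP4 : Graph → Set
TwoEdgeDisjointP4 H = Σ (InducedP4 H) λ c₁ → Σ (InducedP4 H) λ c₂ →
  ∀ (i j k l : Fin 4) → p4adj i j ≡ true → p4adj k l ≡ true →
    ¬ (InducedEmbedding.f c₁ i ≡ InducedEmbedding.f c₂ k ×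
       InducedEmbedding.f c₁ j ≡ InducedEmbedding.f c₂ l)

{-# OPTIONS --safe #-}
-- Deleting a single edge uv destroys an induced copy of P4 only if uv is
-- one of the copy's edges, because an embedding that does not hit uv sees
-- exactly the same adjacencies in G - uv as in G. Two edge-disjoint copies
-- cannot both contain uv, so a graph containing them is not an edge-apex
-- cograph, and minimality of G rules them out in its proper induced
-- subgraphs.
module Submission where

open import Defs hiding (sym)
open import Data.Bool using (true; _∧_; not)
open import Data.Bool.Properties using (∧-identityʳ)
open import Data.Empty using (⊥)
open import Data.Fin using (Fin)
open import Data.Fin.Properties using (_≟_; any?)
open import Data.Product using (∃; _×_; _,_)
open import Data.Sum using (_⊎_; inj₁; inj₂)
open import Relation.Nullary using (¬_; yes; no; _×-dec_; _⊎-dec_)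
open import Relation.Nullary.Decidable using (dec-false)
open import Relation.Binary.PropositionalEquality
  using (_≡_; refl; sym; trans; cong; module ≡-Reasoning)

module _ {G : Graph} {u v : Fin (n G)} where

  deleteEdge-adj : ∀ {a b} → ¬ ((a ≡ u × b ≡ v) ⊎ (a ≡ v × b ≡ u)) →
                   adj (deleteEdge G u v) a b ≡ adj G a b
  -- The edge test hidden inside deleteEdge is definitionally `does` of this decision.
  deleteEdge-adj {a} {b} a≢b≢uv = begin
    adj (deleteEdge G u v) a b
      ≡⟨ cong (λ x → adj G a b ∧ not x)
              (dec-false (((a ≟ u) ×-dec (b ≟ v)) ⊎-dec ((a ≟ v) ×-dec (b ≟ u))) a≢b≢uv) ⟩
    adj G a b ∧ true
      ≡⟨ ∧-identityʳ (adj G a b) ⟩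
    adj G a b ∎
    where open ≡-Reasoning

  module _ {H : Graph} (e : InducedEmbedding H G) where
    open InducedEmbedding e

    Avoids : Set
    Avoids = ∀ i j → f i ≡ u → f j ≡ v → ⊥

    HitsEdge : Set
    HitsEdge = ∃ λ i → ∃ λ j → adj H i j ≡ true × f i ≡ u × f j ≡ v

    avoids⇒embeds-in-deleteEdge : Avoids → InducedEmbedding H (deleteEdge G u v)
    avoids⇒embeds-in-deleteEdge avoid = record
      { f       = f
      ; inj     = inj
      ; preserv = λ i j → trans (preserv i j) (sym (deleteEdge-adj (not-uv i j)))
      }
      where
        not-uv : ∀ i j → ¬ ((f i ≡ u × f j ≡ v) ⊎ (f i ≡ v × f j ≡ u))
        not-uv i j (inj₁ (fi≡u , fj≡v)) = avoid i j fi≡u fj≡v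
        not-uv i j (inj₂ (fi≡v , fj≡u)) = avoid j i fj≡u fi≡v

    embeds-in-deleteEdge⊎hitsEdge : adj G u v ≡ true →
                                    InducedEmbedding H (deleteEdge G u v) ⊎ HitsEdge
    embeds-in-deleteEdge⊎hitsEdge uv∈G
      with any? (λ i → f i ≟ u) | any? (λ j → f j ≟ v)
    ... | no u∉f | _ = inj₁ (avoids⇒embeds-in-deleteEdge (λ i _ fi≡u _ → u∉f (i , fi≡u)))
    ... | yes _ | no v∉f = inj₁ (avoids⇒embeds-in-deleteEdge (λ _ j _ fj≡v → v∉f (j , fj≡v)))
    ... | yes (i , refl) | yes (j , refl) = inj₂ (i , j , trans (preserv i j) uv∈G , refl , refl)

TwoEdgeDisjointP4⇒¬IsEdgeApexCograph : ∀ {H} → TwoEdgeDisjointP4 H → ¬ IsEdgeApexCograph H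
TwoEdgeDisjointP4⇒¬IsEdgeApexCograph (c₁ , _ , _) (inj₁ cograph) = cograph c₁
TwoEdgeDisjointP4⇒¬IsEdgeApexCograph (c₁ , c₂ , disjoint) (inj₂ (u , v , uv∈H , cograph))
  with embeds-in-deleteEdge⊎hitsEdge c₁ uv∈H | embeds-in-deleteEdge⊎hitsEdge c₂ uv∈H
... | inj₁ c₁′ | _ = cograph c₁′
... | inj₂ _ | inj₁ c₂′ = cograph c₂′
... | inj₂ (i , j , ij∈P4 , fi≡u , fj≡v) | inj₂ (k , l , kl∈P4 , gk≡u , gl≡v) =
  disjoint i j k l ij∈P4 kl∈P4 (trans fi≡u (sym gk≡u) , trans fj≡v (sym gl≡v))

lemma3p4 : (G : Graph) → ForbiddenInducedSubgraph G →
    (H : Graph) → ProperInducedSubgraph H G → ¬ TwoEdgeDisjointP4 H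
lemma3p4 G (_ , minimal) H H<G two = TwoEdgeDisjointP4⇒¬IsEdgeApexCograph two (minimal H H<G)
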